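{- Let $G=(V^G,E^G,\ell^G_V,\ell^G_E)$ and $H=(V^H,E^H,\ell^H_V,\ell^H_E)$ be finite undirected labeled graphs with node edit cost function $c_V$ and edge edit cost function $c_E$. Let $\pi$ be a node map between $G$ and $H$, let $K'\geq 2$ be an integer, and let $C\in\mathcal{C}_{\pi,K'}$ be a $K'$-swap of $\pi$. Let $F(C)=C\cap\pi$ and $B(C)=\{(u,v)\mid (v,u)\in C\setminus\pi\}$, and let $\pi'=\mathrm{SWAP}(\pi,C)=(\pi\setminus F(C))\cup\{(u,v)\in B(C)\mid (u,v)\neq(\epsilon,\epsilon)\}$. Define $V^G_C=\{u\in V^G\mid \exists v\in V^H\cup\{\epsilon\}:(u,v)\in F(C)\}$, $V^H_C=\{v\in V^H\mid \exists u\in V^G\cup\{\epsilon\}:(u,v)\in F(C)\}$, $E^G_C=\{e\in E^G\mid e\cap V^G_C\neq\emptyset\}$ and $E^H_C=\{f\in E^H\mid f\cap V^H_C\neq\emptyset\}$. For a node map $\sigma$ define the local cost $$L(\sigma)=\sum_{\substack{u\in V^G_C\\ \sigma(u)\neq\epsilon}}c_V(u,\sigma(u))+\sum_{\substack{u\in V^G_C\\ \sigma(u)=\epsilon}}c_V(u,\epsilon)+\sum_{\substack{v\in V^H_C\\ \sigma^{ -1}(v)=\epsilon}}c_V(\epsilon,v)+\sum_{\substack{e\in E^G_C\\ \sigma(e)\in E^H}}c_E(e,\sigma(e))+\sum_{\substack{e\in E^G_C\\ \sigma(e)\notin E^H}}c_E(e,\epsilon)+\sum_{\substack{f\in E^H_C\\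 \sigma^{ -1}(f)\notin E^G}}c_E(\epsilon,f).$$ Then $c(P_{\pi'})-c(P_\pi)=L(\pi')-L(\pi)$.
   Context: $\epsilon$ is a dummy symbol. A node map $\pi$ between $G$ and $H$ is a set of assignments $(u,v)\in(V^G\cup\{\epsilon\})\times(V^H\cup\{\epsilon\})$ such that each node of $V^G$ and of $V^H$ appears in exactly one assignment; $(u,v)\in\pi$ is written $\pi(u)=v$ and $\pi^{ -1}(v)=u$. For an edge $e=(u,u')\in E^G$, $\pi(e)=(\pi(u),\pi(u'))$, and for $f=(v,v')\in E^H$, $\pi^{ -1}(f)=(\pi^{ -1}(v),\pi^{ -1}(v'))$. The cost of the edit path induced by $\pi$ is $c(P_\pi)=\sum_{u\in V^G,\pi(u)\in V^H}c_V(u,\pi(u))+\sum_{u\in V^G,\pi(u)\notin V^H}c_V(u,\epsilon)+\sum_{v\in V^H,\pi^{ -1}(v)\notin V^G}c_V(\epsilon,v)+\sum_{e\in E^G,\pi(e)\in E^H}c_E(e,\pi(e))+\sum_{e\in E^G,\pi(e)\notin E^H}c_E(e,\epsilon)+\sum_{f\in E^H,\pi^{ -1}(f)\notin E^G}c_E(\epsilon,f)$. Swaps: order $\pi$ as $((u_s,v_s))_{s=1}^{|\pi|}$ and let $G_\pi$ be the directed bipartite graph on the vertices $u_1,\dots,u_{|\pi|},v_1,\dots,v_{|\pi|}$ (one per index, distinct even if some equal $\epsilon$) with arcs $(u_s,v_s)$ for all $s$ (forward arcs) and $(v_s,u_{s'})$ for all $s\neq s'$ (backward arcs). A $K'$-swap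 is a directed cycle in $G_\pi$ with exactly $K'$ forward arcs; $\mathcal{C}_{\pi,K'}$ is the set of all $K'$-swaps. -}

module Defs where

open import Level using (Level)
open import Algebra.Bundles using (AbelianGroup)
open import Data.Bool using (Bool; true; false; _∧_; _∨_; not; if_then_else_)
open import Data.Nat using (ℕ; zero; suc; _<ᵇ_) renaming (_<?_ to _<ℕ?_)
open import Data.Fin using (Fin; toℕ; fromℕ<) renaming (zero to fzero; _≟_ to _≟F_)
open import Data.List using (List; []; _∷_; map; foldr; filterᵇ; findᵇ; concatMap; allFin)
open import Data.Bool.ListAction using (any)
open import Data.Maybe using (Maybe; just; nothing; fromMaybe; is-nothing)
open import Data.Product using (Σ; ∃; _×_; _,_; proj₁; proj₂)
import Data.Maybe.Properties as MaybeP
import Data.Product.Properties as ProdP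
open import Relation.Nullary using (yes; no)
open import Relation.Nullary.Decidable using (⌊_⌋)
open import Relation.Binary.PropositionalEquality using (_≡_)

Node : ℕ → Set
Node n = Maybe (Fin n)

ε : ∀ {n} → Node n
ε = nothing

Pair : ℕ → ℕ → Set
Pair n m = Node n × Node m

_≟N_ : ∀ {n} (x y : Node n) → Relation.Nullary.Dec (x ≡ y)
_≟N_ = MaybeP.≡-dec _≟F_

_≟P_ : ∀ {n m} (x y : Pair n m) → Relation.Nullary.Dec (x ≡ y)
_≟P_ = ProdP.≡-dec _≟N_ _≟N_

nodes : (n : ℕ) → List (Node n)
nodes n = nothing ∷ map just (allFin n)

-- Node/edge labels only enter through the cost
-- functions below, which are arbitrary functions of the nodes/edges.

Adj : ℕ → Set
Adj n = Fin n → Fin n → Bool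

record IsUndirected {n : ℕ} (adj : Adj n) : Set where
  field
    sym   : ∀ u u' → adj u u' ≡ adj u' u
    irrefl : ∀ u → adj u u ≡ false

edges : ∀ {n} → Adj n → List (Fin n × Fin n)
edges {n} adj =
  filterᵇ (λ p → (toℕ (proj₁ p) <ᵇ toℕ (proj₂ p)) ∧ adj (proj₁ p) (proj₂ p))
          (concatMap (λ u → map (λ u' → (u , u')) (allFin n)) (allFin n))

-- Edit cost functions, valued in an abelian group (costs are real numbers
-- in the paper; the statement is a purely additive identity).

record EditCosts {c ℓ : Level} (A : AbelianGroup c ℓ) (n m : ℕ) : Set c where
  open AbelianGroup A using (Carrier)
  field
    cV    : Node n → Node m → Carrier
    cEsub : Fin n → Fin n → Fin m → Fin m → Carrier
    cEdel : Fin n → Fin n → Carrier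
    cEins : Fin m → Fin m → Carrier

record SymmetricEdgeCosts {c ℓ : Level} {A : AbelianGroup c ℓ} {n m : ℕ}
                          (cs : EditCosts A n m) : Set (c Level.⊔ ℓ) where
  open AbelianGroup A using (_≈_)
  open EditCosts cs
  field
    sub-symˡ : ∀ u u' v v' → cEsub u u' v v' ≈ cEsub u' u v v'
    sub-symʳ : ∀ u u' v v' → cEsub u u' v v' ≈ cEsub u u' v' v
    del-sym  : ∀ u u' → cEdel u u' ≈ cEdel u' u
    ins-sym  : ∀ v v' → cEins v v' ≈ cEins v' v

Assignments : ℕ → ℕ → Set
Assignments n m = Node n → Node m → Bool

ExactlyOne : {B : Set} → (B → Set) → Set
ExactlyOne {B} P = Σ B λ b → P b × (∀ b' → P b' → b' ≡ b)

record IsNodeMap {n m : ℕ} (π : Assignments n m) : Set where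
  field
    left  : ∀ (u : Fin n) → ExactlyOne (λ v → π (just u) v ≡ true)
    right : ∀ (v : Fin m) → ExactlyOne (λ u → π u (just v) ≡ true)

-- π(u): the v with (u,v) ∈ π  (found by search; unique for node maps)
img : ∀ {n m} → Assignments n m → Fin n → Node m
img {n} {m} π u = fromMaybe nothing (findᵇ (λ v → π (just u) v) (nodes m))

preimg : ∀ {n m} → Assignments n m → Fin m → Node n
preimg {n} {m} π v = fromMaybe nothing (findᵇ (λ u → π u (just v)) (nodes n))

-- G_π has one u-vertex and one v-vertex per assignment of π.
-- Since backward arcs join v_s to u_{s'} with s ≠ s', a directed cycle with
-- exactly K' ≥ 2 forward arcs is u_{s_0} → v_{s_0} → u_{s_1} → … → v_{s_{K'-1}}
-- → u_{s_0} for pairwise distinct assignments s_0,…,s_{K'-1} of π.  We record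
-- it by the cyclic sequence of these assignments.

next : ∀ {k} → Fin k → Fin k
next {suc k} i with suc (toℕ i) <ℕ? suc k
... | yes p = fromℕ< p
... | no _  = fzero

record Swap {n m : ℕ} (π : Assignments n m) (K' : ℕ) : Set where
  field
    pair     : Fin K' → Pair n m
    inπ      : ∀ i → π (proj₁ (pair i)) (proj₂ (pair i)) ≡ true
    distinct : ∀ i j → pair i ≡ pair j → i ≡ j

module _ {n m : ℕ} {π : Assignments n m} {K' : ℕ} (C : Swap π K') where
  open Swap C

  fwd : Fin K' → Pair n m
  fwd i = pair i

  -- backward arcs (v_{s_i}, u_{s_{i+1}}), reversed to (u_{s_{i+1}}, v_{s_i})
  bwd : Fin K' → Pair n m
  bwd i = (proj₁ (pair (next i)) , proj₂ (pair i))

  inF : Pair n m → Bool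
  inF x = any (λ i → ⌊ fwd i ≟P x ⌋) (allFin K')

  inB : Pair n m → Bool
  inB x = any (λ i → ⌊ bwd i ≟P x ⌋) (allFin K')

  SWAP : Assignments n m
  SWAP u v = (π u v ∧ not (inF (u , v)))
           ∨ (inB (u , v) ∧ not (is-nothing u ∧ is-nothing v))

  inVGC : Fin n → Bool
  inVGC u = any (λ v → inF (just u , v)) (nodes m)

  inVHC : Fin m → Bool
  inVHC v = any (λ u → inF (u , just v)) (nodes n)

  VGC : List (Fin n)
  VGC = filterᵇ inVGC (allFin n)

  VHC : List (Fin m)
  VHC = filterᵇ inVHC (allFin m)

  EGC : Adj n → List (Fin n × Fin n)
  EGC adjG = filterᵇ (λ e → inVGC (proj₁ e) ∨ inVGC (proj₂ e)) (edges adjG)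

  EHC : Adj m → List (Fin m × Fin m)
  EHC adjH = filterᵇ (λ f → inVHC (proj₁ f) ∨ inVHC (proj₂ f)) (edges adjH)

module _ {c ℓ : Level} (A : AbelianGroup c ℓ) where
  open AbelianGroup A renaming (ε to 0#)

  sumL : {B : Set} → (B → Carrier) → List B → Carrier
  sumL f xs = foldr (λ x r → f x ∙ r) 0# xs

  costOn : ∀ {n m} → EditCosts A n m → Adj n → Adj m → Assignments n m →
           List (Fin n) → List (Fin m) → List (Fin n × Fin n) → List (Fin m × Fin m) →
           Carrier
  costOn {n} {m} cs adjG adjH σ VG VH EG EH =
      sumL (λ u → cV (just u) (img σ u)) VG
    ∙ (sumL (λ v → cV nothing (just v))
            (filterᵇ (λ v → is-nothing (preimg σ v)) VH)
    ∙ (sumL edgeG EG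
    ∙ sumL edgeH EH))
    where
    open EditCosts cs
    edgeGAux : Fin n → Fin n → Node m → Node m → Carrier
    edgeGAux u u' (just v) (just v') = if adjH v v' then cEsub u u' v v' else cEdel u u'
    edgeGAux u u' _ _ = cEdel u u'
    edgeG : Fin n × Fin n → Carrier
    edgeG (u , u') = edgeGAux u u' (img σ u) (img σ u')
    edgeHAux : Fin m → Fin m → Node n → Node n → Carrier
    edgeHAux v v' (just u) (just u') = if adjG u u' then 0# else cEins v v'
    edgeHAux v v' _ _ = cEins v v'
    edgeH : Fin m × Fin m → Carrier
    edgeH (v , v') = edgeHAux v v' (preimg σ v) (preimg σ v')

  pathCost : ∀ {n m} → EditCosts A n m → Adj n → Adj m → Assignments n m → Carrier
  pathCost {n} {m} cs adjG adjH σ =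
    costOn cs adjG adjH σ (allFin n) (allFin m) (edges adjG) (edges adjH)

  localCost : ∀ {n m} {π : Assignments n m} {K' : ℕ} → Swap π K' →
              EditCosts A n m → Adj n → Adj m → Assignments n m → Carrier
  localCost C cs adjG adjH σ =
    costOn cs adjG adjH σ (VGC C) (VHC C) (EGC C adjG) (EHC C adjH)

-- Every backward arc of the swap C joins a u-vertex and a v-vertex of forward
-- arcs of C, so SWAP(π,C) and π contain the same assignments of each node
-- outside V^G_C and V^H_C.  Hence π and π' give such nodes the same image
-- and preimage, and every node or edge outside V^G_C, V^H_C, E^G_C, E^H_C
-- contributes the same summand to c(P_π) and c(P_π'); these summands cancel
-- in the difference, leaving L(π') - L(π).

module Submission where

open import Defs
open import Level using (Level)
open import Algebra.Bundles using (AbelianGroup)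
open import Data.Nat using (ℕ; _≥_)
open import Data.Bool using (Bool; true; false; _∨_; not; if_then_else_)
open import Data.Bool.Properties using (∨-conicalˡ; ∨-conicalʳ; ∨-identityʳ; ∧-identityʳ)
open import Data.Bool.ListAction using (any)
open import Data.Fin using (Fin)
open import Data.List using (List; []; _∷_; filterᵇ; findᵇ; allFin)
open import Data.List.Membership.Propositional using (_∈_)
open import Data.List.Membership.Propositional.Properties using (∈-allFin; ∈-map⁺)
open import Data.List.Relation.Unary.Any using (here; there)
open import Data.Maybe using (just; nothing; is-nothing; fromMaybe)
open import Data.Product using (_×_; _,_; proj₁; proj₂)
open import Function using (_∘_)
open import Relation.Nullary using (¬_)
open import Relation.Nullary.Decidable using (Dec; ⌊_⌋; isYes≗does; dec-true; dec-false)
open import Relation.Binary.PropositionalEquality using (_≡_; _≢_; refl; sym; trans; cong)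
import Algebra.Properties.AbelianGroup as AbelianGroupProperties
import Algebra.Properties.CommutativeSemigroup as CommutativeSemigroupProperties
import Relation.Binary.Reasoning.Setoid as SetoidReasoning

any-≡-false : ∀ {B : Set} {p : B → Bool} {xs x} → any p xs ≡ false → x ∈ xs → p x ≡ false
any-≡-false {p = p} {y ∷ _} h (here refl) = ∨-conicalˡ (p y) _ h
any-≡-false {p = p} {y ∷ _} h (there x∈xs) = any-≡-false (∨-conicalʳ (p y) _ h) x∈xs

any-≡-false⁺ : ∀ {B : Set} {p : B → Bool} → (∀ x → p x ≡ false) → ∀ xs → any p xs ≡ false
any-≡-false⁺ h [] = refl
any-≡-false⁺ h (x ∷ xs) rewrite h x = any-≡-false⁺ h xs

findᵇ-cong : ∀ {B : Set} {p q : B → Bool} → (∀ x → p x ≡ q x) → ∀ xs → findᵇ p xs ≡ findᵇ q xs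
findᵇ-cong h [] = refl
findᵇ-cong {q = q} h (x ∷ xs) rewrite h x with q x
... | true = refl
... | false = findᵇ-cong h xs

⌊⌋-true : ∀ {a} {P : Set a} (P? : Dec P) → P → ⌊ P? ⌋ ≡ true
⌊⌋-true P? p = trans (isYes≗does P?) (dec-true P? p)

⌊⌋-false : ∀ {a} {P : Set a} (P? : Dec P) → ¬ P → ⌊ P? ⌋ ≡ false
⌊⌋-false P? ¬p = trans (isYes≗does P?) (dec-false P? ¬p)

∈-nodes : ∀ {k} (x : Node k) → x ∈ nodes k
∈-nodes nothing = here refl
∈-nodes (just i) = there (∈-map⁺ just (∈-allFin i))

img-cong : ∀ {n m} {σ τ : Assignments n m} {u} →
           (∀ v → σ (just u) v ≡ τ (just u) v) → img σ u ≡ img τ u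
img-cong {m = m} h = cong (fromMaybe nothing) (findᵇ-cong h (nodes m))

preimg-cong : ∀ {n m} {σ τ : Assignments n m} {v} →
              (∀ u → σ u (just v) ≡ τ u (just v)) → preimg σ v ≡ preimg τ v
preimg-cong {n = n} h = cong (fromMaybe nothing) (findᵇ-cong h (nodes n))

module _ {n m : ℕ} {π : Assignments n m} {K' : ℕ} (C : Swap π K') where
  open Swap C

  pair-∉-F : ∀ {x} → inF C x ≡ false → ∀ i → pair i ≢ x
  pair-∉-F h i eq with trans (sym (⌊⌋-true (pair i ≟P _) eq)) (any-≡-false h (∈-allFin i))
  ... | ()

  inF-outsideˡ : ∀ {u} → inVGC C u ≡ false → ∀ v → inF C (just u , v) ≡ false
  inF-outsideˡ h v = any-≡-false h (∈-nodes v)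

  inF-outsideʳ : ∀ {v} → inVHC C v ≡ false → ∀ u → inF C (u , just v) ≡ false
  inF-outsideʳ h u = any-≡-false h (∈-nodes u)

  -- The backward arc i leaves v_{s_i} towards u_{s_{i+1}}: its endpoints
  -- are those of the forward arcs next i (left) and i (right).
  inB-outsideˡ : ∀ {u} → inVGC C u ≡ false → ∀ v → inB C (just u , v) ≡ false
  inB-outsideˡ {u} h v = any-≡-false⁺ arc-elsewhere (allFin K')
    where
    arc-elsewhere : ∀ i → ⌊ bwd C i ≟P (just u , v) ⌋ ≡ false
    arc-elsewhere i = ⌊⌋-false (bwd C i ≟P _) λ eq →
      pair-∉-F (inF-outsideˡ h _) (next i) (cong (_, proj₂ (pair (next i))) (cong proj₁ eq))

  inB-outsideʳ : ∀ {v} → inVHC C v ≡ false → ∀ u → inB C (u , just v) ≡ false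
  inB-outsideʳ {v} h u = any-≡-false⁺ arc-elsewhere (allFin K')
    where
    arc-elsewhere : ∀ i → ⌊ bwd C i ≟P (u , just v) ⌋ ≡ false
    arc-elsewhere i = ⌊⌋-false (bwd C i ≟P _) λ eq →
      pair-∉-F (inF-outsideʳ h _) i (cong (proj₁ (pair i) ,_) (cong proj₂ eq))

  SWAP-outsideˡ : ∀ {u} → inVGC C u ≡ false → ∀ v → SWAP C (just u) v ≡ π (just u) v
  SWAP-outsideˡ h v rewrite inF-outsideˡ h v | inB-outsideˡ h v =
    trans (∨-identityʳ _) (∧-identityʳ _)

  SWAP-outsideʳ : ∀ {v} → inVHC C v ≡ false → ∀ u → SWAP C u (just v) ≡ π u (just v)
  SWAP-outsideʳ h u rewrite inF-outsideʳ h u | inB-outsideʳ h u =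
    trans (∨-identityʳ _) (∧-identityʳ _)

  img-SWAP-outside : ∀ u → inVGC C u ≡ false → img (SWAP C) u ≡ img π u
  img-SWAP-outside u h = img-cong {σ = SWAP C} {π} (SWAP-outsideˡ h)

  preimg-SWAP-outside : ∀ v → inVHC C v ≡ false → preimg (SWAP C) v ≡ preimg π v
  preimg-SWAP-outside v h = preimg-cong {σ = SWAP C} {π} (SWAP-outsideʳ h)

module _ {c ℓ : Level} (A : AbelianGroup c ℓ) where
  open AbelianGroup A renaming (ε to 0#; refl to ≈-refl; sym to ≈-sym; trans to ≈-trans)
  open AbelianGroupProperties A using (⁻¹-∙-comm)
  open CommutativeSemigroupProperties commutativeSemigroup using (interchange; x∙yz≈y∙xz)
  open SetoidReasoning setoid

  -cong : ∀ {a a' b b'} → a ≈ a' → b ≈ b' → a - b ≈ a' - b'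
  -cong eq₁ eq₂ = ∙-cong eq₁ (⁻¹-cong eq₂)

  -∙-interchange : ∀ a b a' b' → (a ∙ b) - (a' ∙ b') ≈ (a - a') ∙ (b - b')
  -∙-interchange a b a' b' = ≈-trans (∙-congˡ (≈-sym (⁻¹-∙-comm a' b'))) (interchange a b (a' ⁻¹) (b' ⁻¹))

  -∙-cong : ∀ {a b a' b' x y x' y'} → a - a' ≈ x - x' → b - b' ≈ y - y' →
            (a ∙ b) - (a' ∙ b') ≈ (x ∙ y) - (x' ∙ y')
  -∙-cong {a} {b} {a'} {b'} {x} {y} {x'} {y'} eq₁ eq₂ = begin
    (a ∙ b) - (a' ∙ b')     ≈⟨ -∙-interchange a b a' b' ⟩
    (a - a') ∙ (b - b')     ≈⟨ ∙-cong eq₁ eq₂ ⟩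
    (x - x') ∙ (y - y')     ≈⟨ -∙-interchange x y x' y' ⟨
    (x ∙ y) - (x' ∙ y')     ∎

  sumL-filterᵇ : ∀ {B : Set} (f : B → Carrier) (p : B → Bool) xs →
                 sumL A f (filterᵇ p xs) ≈ sumL A (λ x → if p x then f x else 0#) xs
  sumL-filterᵇ f p [] = ≈-refl
  sumL-filterᵇ f p (x ∷ xs) with p x
  ... | true = ∙-congˡ (sumL-filterᵇ f p xs)
  ... | false = ≈-trans (sumL-filterᵇ f p xs) (≈-sym (identityˡ _))

  sumL-partition : ∀ {B : Set} (f : B → Carrier) (p : B → Bool) xs →
                   sumL A f xs ≈ sumL A f (filterᵇ p xs) ∙ sumL A f (filterᵇ (not ∘ p) xs)
  sumL-partition f p [] = ≈-sym (identityˡ 0#)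
  sumL-partition f p (x ∷ xs) with p x
  ... | true = ≈-trans (∙-congˡ (sumL-partition f p xs)) (≈-sym (assoc _ _ _))
  ... | false = ≈-trans (∙-congˡ (sumL-partition f p xs)) (x∙yz≈y∙xz _ _ _)

  sumL-cong-rejected : ∀ {B : Set} {f g : B → Carrier} (p : B → Bool) →
                       (∀ x → p x ≡ false → f x ≈ g x) → ∀ xs →
                       sumL A f (filterᵇ (not ∘ p) xs) ≈ sumL A g (filterᵇ (not ∘ p) xs)
  sumL-cong-rejected p h [] = ≈-refl
  sumL-cong-rejected p h (x ∷ xs) with p x in eq
  ... | true = sumL-cong-rejected p h xs
  ... | false = ∙-cong (h x eq) (sumL-cong-rejected p h xs)

  sumL-difference-filterᵇ : ∀ {B : Set} {f g : B → Carrier} (p : B → Bool) →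
    (∀ x → p x ≡ false → f x ≈ g x) → ∀ xs →
    sumL A f xs - sumL A g xs ≈ sumL A f (filterᵇ p xs) - sumL A g (filterᵇ p xs)
  sumL-difference-filterᵇ {B} {f} {g} p h xs = begin
    sumL A f xs - sumL A g xs
      ≈⟨ -cong (sumL-partition f p xs) (sumL-partition g p xs) ⟩
    (sumL A f (filterᵇ p xs) ∙ sumL A f rejected) - (sumL A g (filterᵇ p xs) ∙ sumL A g rejected)
      ≈⟨ -∙-interchange _ _ _ _ ⟩
    (sumL A f (filterᵇ p xs) - sumL A g (filterᵇ p xs)) ∙ (sumL A f rejected - sumL A g rejected)
      ≈⟨ ∙-congˡ (≈-trans (∙-congʳ (sumL-cong-rejected p h xs)) (inverseʳ _)) ⟩
    (sumL A f (filterᵇ p xs) - sumL A g (filterᵇ p xs)) ∙ 0#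
      ≈⟨ identityʳ _ ⟩
    sumL A f (filterᵇ p xs) - sumL A g (filterᵇ p xs) ∎
    where
    rejected : List B
    rejected = filterᵇ (not ∘ p) xs

  sumL-filtered-difference-filterᵇ : ∀ {B : Set} (f : B → Carrier) {r s : B → Bool} (p : B → Bool) →
    (∀ x → p x ≡ false → r x ≡ s x) → ∀ xs →
    sumL A f (filterᵇ r xs) - sumL A f (filterᵇ s xs)
      ≈ sumL A f (filterᵇ r (filterᵇ p xs)) - sumL A f (filterᵇ s (filterᵇ p xs))
  sumL-filtered-difference-filterᵇ {B} f {r} {s} p h xs = begin
    sumL A f (filterᵇ r xs) - sumL A f (filterᵇ s xs)
      ≈⟨ -cong (sumL-filterᵇ f r xs) (sumL-filterᵇ f s xs) ⟩
    sumL A (guarded r) xs - sumL A (guarded s) xs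
      ≈⟨ sumL-difference-filterᵇ p (λ x e → reflexive (cong (λ b → if b then f x else 0#) (h x e))) xs ⟩
    sumL A (guarded r) (filterᵇ p xs) - sumL A (guarded s) (filterᵇ p xs)
      ≈⟨ -cong (sumL-filterᵇ f r (filterᵇ p xs)) (sumL-filterᵇ f s (filterᵇ p xs)) ⟨
    sumL A f (filterᵇ r (filterᵇ p xs)) - sumL A f (filterᵇ s (filterᵇ p xs)) ∎
    where
    guarded : (B → Bool) → B → Carrier
    guarded t x = if t x then f x else 0#

touching : ∀ {k} → (Fin k → Bool) → List (Fin k × Fin k) → List (Fin k × Fin k)
touching p = filterᵇ (λ e → p (proj₁ e) ∨ p (proj₂ e))

module _ {c ℓ : Level} (A : AbelianGroup c ℓ) {n m : ℕ}
         (cs : EditCosts A n m) (adjG : Adj n) (adjH : Adj m) where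
  open AbelianGroup A renaming (ε to 0#; refl to ≈-refl; sym to ≈-sym; trans to ≈-trans)
  open EditCosts cs

  -- The per-edge summands of costOn live in its where block; costOn on a single
  -- edge exposes them, padded with units.  They ignore costOn's list arguments,
  -- so Agda identifies them with the summands inside pathCost and localCost.
  edgeCostᴳ : Assignments n m → Fin n × Fin n → Carrier
  edgeCostᴳ σ e = costOn A cs adjG adjH σ [] [] (e ∷ []) []

  edgeCostᴴ : Assignments n m → Fin m × Fin m → Carrier
  edgeCostᴴ σ f = costOn A cs adjG adjH σ [] [] [] (f ∷ [])

  edgeCostᴳ-unpad : ∀ {a b} → 0# ∙ (0# ∙ ((a ∙ 0#) ∙ 0#)) ≈ 0# ∙ (0# ∙ ((b ∙ 0#) ∙ 0#)) → a ≈ b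
  edgeCostᴳ-unpad {a} {b} eq = ≈-trans (≈-sym (unpad a)) (≈-trans eq (unpad b))
    where
    unpad : ∀ x → 0# ∙ (0# ∙ ((x ∙ 0#) ∙ 0#)) ≈ x
    unpad x = ≈-trans (identityˡ _) (≈-trans (identityˡ _) (≈-trans (identityʳ _) (identityʳ _)))

  edgeCostᴴ-unpad : ∀ {a b} → 0# ∙ (0# ∙ (0# ∙ (a ∙ 0#))) ≈ 0# ∙ (0# ∙ (0# ∙ (b ∙ 0#))) → a ≈ b
  edgeCostᴴ-unpad {a} {b} eq = ≈-trans (≈-sym (unpad a)) (≈-trans eq (unpad b))
    where
    unpad : ∀ x → 0# ∙ (0# ∙ (0# ∙ (x ∙ 0#))) ≈ x
    unpad x = ≈-trans (identityˡ _) (≈-trans (identityˡ _) (≈-trans (identityˡ _) (identityʳ _)))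

  edgeCostᴳ-cong : ∀ {σ τ : Assignments n m} {u u'} →
    img σ u ≡ img τ u → img σ u' ≡ img τ u' → edgeCostᴳ σ (u , u') ≈ edgeCostᴳ τ (u , u')
  edgeCostᴳ-cong {σ} {τ} {u} {u'} eq eq' rewrite eq | eq' with img τ u | img τ u'
  ... | just _ | just _ = ≈-refl
  ... | just _ | nothing = ≈-refl
  ... | nothing | _ = ≈-refl

  edgeCostᴴ-cong : ∀ {σ τ : Assignments n m} {v v'} →
    preimg σ v ≡ preimg τ v → preimg σ v' ≡ preimg τ v' → edgeCostᴴ σ (v , v') ≈ edgeCostᴴ τ (v , v')
  edgeCostᴴ-cong {σ} {τ} {v} {v'} eq eq' rewrite eq | eq' with preimg τ v | preimg τ v'
  ... | just _ | just _ = ≈-refl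
  ... | just _ | nothing = ≈-refl
  ... | nothing | _ = ≈-refl

  pathCost-difference-local :
    (σ τ : Assignments n m) (p : Fin n → Bool) (q : Fin m → Bool) →
    (∀ u → p u ≡ false → img σ u ≡ img τ u) →
    (∀ v → q v ≡ false → preimg σ v ≡ preimg τ v) →
    let local : Assignments n m → Carrier
        local ρ = costOn A cs adjG adjH ρ (filterᵇ p (allFin n)) (filterᵇ q (allFin m))
                         (touching p (edges adjG)) (touching q (edges adjH))
    in pathCost A cs adjG adjH σ - pathCost A cs adjG adjH τ ≈ local σ - local τ
  pathCost-difference-local σ τ p q img≡ preimg≡ =
    -∙-cong A
      (sumL-difference-filterᵇ A p
        (λ u h → reflexive (cong (cV (just u)) (img≡ u h))) (allFin n))
      (-∙-cong A
        (sumL-filtered-difference-filterᵇ A (λ v → cV nothing (just v)) q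
          (λ v h → cong is-nothing (preimg≡ v h)) (allFin m))
        (-∙-cong A
          (sumL-difference-filterᵇ A _
            (λ { (u , u') h → edgeCostᴳ-unpad (edgeCostᴳ-cong {σ} {τ}
                   (img≡ u (∨-conicalˡ _ _ h)) (img≡ u' (∨-conicalʳ _ _ h))) })
            (edges adjG))
          (sumL-difference-filterᵇ A _
            (λ { (v , v') h → edgeCostᴴ-unpad (edgeCostᴴ-cong {σ} {τ}
                   (preimg≡ v (∨-conicalˡ _ _ h)) (preimg≡ v' (∨-conicalʳ _ _ h))) })
            (edges adjH))))

proposition2 : ∀ {c ℓ : Level} (A : AbelianGroup c ℓ) (n m : ℕ)
    (adjG : Adj n) (adjH : Adj m) → IsUndirected adjG → IsUndirected adjH →
    (cs : EditCosts A n m) → SymmetricEdgeCosts cs →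
    (π : Assignments n m) → IsNodeMap π →
    (K' : ℕ) → K' ≥ 2 → (C : Swap π K') →
    let open AbelianGroup A in
    (pathCost A cs adjG adjH (SWAP C) - pathCost A cs adjG adjH π)
      ≈ (localCost A C cs adjG adjH (SWAP C) - localCost A C cs adjG adjH π)
proposition2 A _ _ adjG adjH _ _ cs _ π _ _ _ C =
  pathCost-difference-local A cs adjG adjH (SWAP C) π (inVGC C) (inVHC C)
    (img-SWAP-outside C) (preimg-SWAP-outside C)
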